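{- Let $m,n\in\mathbb{N}$ and $T\in\mathbb{Z}$. (i) If $m\in\{2,3\}$, then $T\in\mathscr{S}_m(n)$ if and only if the binary form $mX^2+2TXY+nY^2$ is a sum of $m$ squares of integral linear forms, i.e. there exist $a_i,b_i\in\mathbb{Z}$ ($1\le i\le m$) with $\sum_{i=1}^m(a_iX+b_iY)^2=mX^2+2TXY+nY^2$ in $\mathbb{Z}[X,Y]$. (ii) If $4\le m\le 7$, then $T\in\mathscr{S}_m(n)$ if and only if $T\equiv n\pmod 2$ and $mX^2+2TXY+nY^2$ is a sum of $m$ squares of integral linear forms.
   Context: $\mathbb{N}$ denotes the positive integers. For $m,n\in\mathbb{N}$, $\mathscr{S}_m(n)$ is the set of all $T\in\mathbb{Z}$ for which there exist $x_1,\ldots,x_m\in\mathbb{Z}$ with $x_1+\cdots+x_m=T$ and $x_1^2+\cdots+x_m^2=n$. -}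

module Defs where

open import Data.Nat using (ℕ; suc)
open import Data.Fin using (Fin; zero; suc)
open import Data.Integer using (ℤ; +_; _+_; _*_; _-_)
open import Data.Product using (Σ; _×_)
open import Relation.Binary.PropositionalEquality using (_≡_)

sumℤ : (m : ℕ) → (Fin m → ℤ) → ℤ
sumℤ ℕ.zero    f = + 0
sumℤ (suc m) f = f zero + sumℤ m (λ i → f (suc i))

S : ℕ → ℕ → ℤ → Set
S m n T = Σ (Fin m → ℤ) λ x → (sumℤ m x ≡ T) × (sumℤ m (λ i → x i * x i) ≡ + n)

-- The binary quadratic form A X² + 2B XY + C Y² (coefficients A, B, C ∈ ℤ)
-- is a sum of m squares of integral linear forms a_i X + b_i Y in ℤ[X,Y]:
-- Σ (a_i X + b_i Y)² = Σ a_i² X² + 2 (Σ a_i b_i) XY + Σ b_i² Y²,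
-- so equality in ℤ[X,Y] means equality of the coefficients of X², XY, Y².
SumOfSquaresOfLinearForms : ℕ → ℤ → ℤ → ℤ → Set
SumOfSquaresOfLinearForms m A B C =
  Σ (Fin m → ℤ) λ a → Σ (Fin m → ℤ) λ b →
    (sumℤ m (λ i → a i * a i) ≡ A)
    × (sumℤ m (λ i → (+ 2) * (a i * b i)) ≡ (+ 2) * B)
    × (sumℤ m (λ i → b i * b i) ≡ C)

-- A form Σ (a_i X + b_i Y)² has coefficients |a|², 2 a·b, |b|², so the
-- hypothesis is a pair of vectors a, b ∈ ℤ^m with |a|² = m, a·b = T, |b|² = n.
-- Forward: if x realises T ∈ 𝒮_m(n), take a = (1,…,1), b = x; moreover
-- x ≡ x² (mod 2) gives T = Σ x_i ≡ Σ x_i² = n.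
-- Backward: as |a|² = m ≤ 7 < 9, every a_i lies in {0, ±1, ±2}.  We sort the
-- entries into a `Split`: ε b_i for a_i = ε = ±1 ("units"), b_i for a_i = 0
-- ("zeros") and ε b_i for a_i = 2ε ("doubles").  Counting entries and |a|²
-- forces #zeros = 3·#doubles and 4·#doubles ≤ 7, so either
--   * there are no zeros and no doubles, and the units themselves realise T; or
--   * there is one double s and three zeros u, v, w; then s+u+v+w is even
--     (this is where T ≡ n mod 2 enters) and, with 2q = s+u+v+w, the four
--     integers q, q-v-w, q-u-w, q-u-v have sum 2s and square sum s²+u²+v²+w²,
--     so together with the units they realise T.
module Submission where

open import Defs
open import Data.Nat using (ℕ; _≤_; NonZero)
open import Data.Integer using (ℤ; +_; _-_)
open import Data.Integer.Divisibility using (_∣_)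
open import Data.Product using (_×_)
open import Data.Sum using (_⊎_)
open import Function.Bundles using (_⇔_)
open import Relation.Binary.PropositionalEquality using (_≡_)

import Data.Nat as ℕ
open import Data.Nat using (zero; suc; z≤n; s≤s)
import Data.Nat.Properties as ℕP
import Data.Nat.Tactic.RingSolver as ℕSolver
open import Data.Integer using (-[1+_]; _+_; _*_; -_; +≤+)
import Data.Integer as ℤ
import Data.Integer.Properties as ℤP
import Data.Integer.Divisibility.Signed as Signed
open import Data.Integer.DivMod using (_%ℕ_; _/ℕ_; n%ℕd<d; a≡a%ℕn+[a/ℕn]*n)
open import Data.Integer.Tactic.RingSolver using (solve-∀)
open import Data.Fin using (Fin) renaming (zero to fzero; suc to fsuc)
open import Data.List using (List; []; _∷_; length; map; _++_; lookup; tabulate)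
import Data.List.Properties as ListP
open import Data.Product using (Σ; _,_; proj₁; proj₂)
open import Data.Sum using (inj₁; inj₂)
open import Data.Empty using (⊥; ⊥-elim)
open import Function.Bundles using (mk⇔; Equivalence)
open import Relation.Binary.PropositionalEquality
  using (refl; sym; trans; cong; cong₂; subst; module ≡-Reasoning)

sq : ℤ → ℤ
sq x = x * x

sumList : List ℤ → ℤ
sumList []       = + 0
sumList (x ∷ xs) = x + sumList xs

squareSum : List ℤ → ℤ
squareSum xs = sumList (map sq xs)

sumList-++ : ∀ xs ys → sumList (xs ++ ys) ≡ sumList xs + sumList ys
sumList-++ []       ys = sym (ℤP.+-identityˡ (sumList ys))
sumList-++ (x ∷ xs) ys = trans (cong (_+_ x) (sumList-++ xs ys)) (sym (ℤP.+-assoc x _ _))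

sumℤ-cong : ∀ k {f g : Fin k → ℤ} → (∀ i → f i ≡ g i) → sumℤ k f ≡ sumℤ k g
sumℤ-cong zero    f≗g = refl
sumℤ-cong (suc k) f≗g = cong₂ _+_ (f≗g fzero) (sumℤ-cong k (λ i → f≗g (fsuc i)))

sumℤ-*ˡ : ∀ k c (f : Fin k → ℤ) → sumℤ k (λ i → c * f i) ≡ c * sumℤ k f
sumℤ-*ˡ zero    c f = sym (ℤP.*-zeroʳ c)
sumℤ-*ˡ (suc k) c f = trans (cong (_+_ (c * f fzero)) (sumℤ-*ˡ k c (λ i → f (fsuc i))))
                            (sym (ℤP.*-distribˡ-+ c (f fzero) _))

sumℤ-one : ∀ k → sumℤ k (λ _ → + 1) ≡ + k
sumℤ-one zero    = refl
sumℤ-one (suc k) = cong (_+_ (+ 1)) (sumℤ-one k)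

sumℤ≡sumList : ∀ k (f : Fin k → ℤ) → sumℤ k f ≡ sumList (tabulate f)
sumℤ≡sumList zero    f = refl
sumℤ≡sumList (suc k) f = cong (_+_ (f fzero)) (sumℤ≡sumList k (λ i → f (fsuc i)))

Realizable : ℕ → ℤ → ℤ → Set
Realizable k T N = Σ (List ℤ) λ xs →
  (length xs ≡ k) × (sumList xs ≡ T) × (squareSum xs ≡ N)

S⇔Realizable : ∀ m n T → S m n T ⇔ Realizable m T (+ n)
S⇔Realizable m n T = mk⇔ toList fromList
  where
    toList : S m n T → Realizable m T (+ n)
    toList (x , Σx≡T , Σx²≡n) =
      tabulate x , ListP.length-tabulate x ,
      trans (sym (sumℤ≡sumList m x)) Σx≡T ,
      (begin
        squareSum (tabulate x) ≡⟨ cong sumList (ListP.map-tabulate x sq) ⟩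
        sumList (tabulate (λ i → sq (x i))) ≡⟨ sym (sumℤ≡sumList m (λ i → sq (x i))) ⟩
        sumℤ m (λ i → x i * x i) ≡⟨ Σx²≡n ⟩
        + n ∎)
      where open ≡-Reasoning
    fromList : Realizable m T (+ n) → S m n T
    fromList (xs , refl , Σxs≡T , Σxs²≡n) =
      lookup xs ,
      trans (sumℤ≡sumList m (lookup xs)) (trans (cong sumList (ListP.tabulate-lookup xs)) Σxs≡T) ,
      (begin
        sumℤ m (λ i → sq (lookup xs i)) ≡⟨ sumℤ≡sumList m (λ i → sq (lookup xs i)) ⟩
        sumList (tabulate (λ i → sq (lookup xs i))) ≡⟨ cong sumList (sym (ListP.map-tabulate (lookup xs) sq)) ⟩
        squareSum (tabulate (lookup xs)) ≡⟨ cong squareSum (ListP.tabulate-lookup xs) ⟩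
        squareSum xs ≡⟨ Σxs²≡n ⟩
        + n ∎)
      where open ≡-Reasoning

Realizable-++ : ∀ {k k′ T T′ N N′} → Realizable k T N → Realizable k′ T′ N′ →
  Realizable (k ℕ.+ k′) (T + T′) (N + N′)
Realizable-++ (xs , refl , refl , refl) (ys , refl , refl , refl) =
  xs ++ ys , ListP.length-++ xs ,
  sumList-++ xs ys ,
  trans (cong sumList (ListP.map-++ sq xs ys)) (sumList-++ (map sq xs) (map sq ys))

Even : ℤ → Set
Even x = + 2 Signed.∣ x

x-x²-even : ∀ x → Even (x - x * x)
x-x²-even x = byRemainder (x %ℕ 2) (x /ℕ 2) (n%ℕd<d x 2) (a≡a%ℕn+[a/ℕn]*n x 2)
  where
    byRemainder : ∀ r q → r ℕ.< 2 → x ≡ + r + q * + 2 → Even (x - x * x)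
    byRemainder 0 q _ refl = Signed.divides (q - q * q * + 2) (identity q)
      where
        identity : ∀ q → (+ 0 + q * + 2) - (+ 0 + q * + 2) * (+ 0 + q * + 2) ≡ (q - q * q * + 2) * + 2
        identity = solve-∀
    byRemainder 1 q _ refl = Signed.divides (- (q * (+ 1 + q * + 2))) (identity q)
      where
        identity : ∀ q → (+ 1 + q * + 2) - (+ 1 + q * + 2) * (+ 1 + q * + 2) ≡ (- (q * (+ 1 + q * + 2))) * + 2
        identity = solve-∀
    byRemainder (suc (suc _)) q (s≤s (s≤s ())) _

sum-parity : ∀ xs → Even (sumList xs - squareSum xs)
sum-parity []       = Signed.divides (+ 0) refl
sum-parity (x ∷ xs) =
  subst Even (sym (regroup x (sumList xs) (sq x) (squareSum xs)))
    (Signed.∣m∣n⇒∣m+n (x-x²-even x) (sum-parity xs))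
  where
    regroup : ∀ a A b B → (a + A) - (b + B) ≡ (a - b) + (A - B)
    regroup = solve-∀

-- This trades one coefficient 2 and three coefficients 0 for four 1's.
replace-double : ∀ s u v w → Even (s + u + v + w) →
  Realizable 4 (+ 2 * s) (s * s + u * u + v * v + w * w)
replace-double s u v w (Signed.divides q sum≡2q) =
  subst (λ s → Realizable 4 (+ 2 * s) (s * s + u * u + v * v + w * w)) (sym s≡) (quadruple q)
  where
    s≡ : s ≡ q * + 2 - (u + v + w)
    s≡ = trans (isolate s u v w) (cong (_- (u + v + w)) sum≡2q)
      where
        isolate : ∀ s u v w → s ≡ (s + u + v + w) - (u + v + w)
        isolate = solve-∀
    sumIdentity : ∀ q u v w →
      q + ((q - v - w) + ((q - u - w) + ((q - u - v) + + 0))) ≡ + 2 * (q * + 2 - (u + v + w))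
    sumIdentity = solve-∀
    squareIdentity : ∀ q u v w → let s = q * + 2 - (u + v + w) in
      q * q + ((q - v - w) * (q - v - w) + ((q - u - w) * (q - u - w) + ((q - u - v) * (q - u - v) + + 0)))
        ≡ s * s + u * u + v * v + w * w
    squareIdentity = solve-∀
    quadruple : ∀ q → let s = q * + 2 - (u + v + w) in
      Realizable 4 (+ 2 * s) (s * s + u * u + v * v + w * w)
    quadruple q = q ∷ (q - v - w) ∷ (q - u - w) ∷ (q - u - v) ∷ [] , refl ,
                  sumIdentity q u v w , squareIdentity q u v w

Gram : ℕ → ℤ → ℤ → ℤ → Set
Gram m A D B = Σ (Fin m → ℤ) λ a → Σ (Fin m → ℤ) λ b →
  (sumℤ m (λ i → a i * a i) ≡ A) × (sumℤ m (λ i → a i * b i) ≡ D)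
    × (sumℤ m (λ i → b i * b i) ≡ B)

SumOfSquares⇔Gram : ∀ m A D B → SumOfSquaresOfLinearForms m A D B ⇔ Gram m A D B
SumOfSquares⇔Gram m A D B = mk⇔
  (λ (a , b , |a|² , 2a·b , |b|²) →
     a , b , |a|² , ℤP.*-cancelˡ-≡ (+ 2) _ D (trans (sym (twice a b)) 2a·b) , |b|²)
  (λ (a , b , |a|² , a·b , |b|²) →
     a , b , |a|² , trans (twice a b) (cong (+ 2 *_) a·b) , |b|²)
  where
    twice : ∀ (a b : Fin m → ℤ) →
      sumℤ m (λ i → + 2 * (a i * b i)) ≡ + 2 * sumℤ m (λ i → a i * b i)
    twice a b = sumℤ-*ˡ m (+ 2) (λ i → a i * b i)

square-nonneg : ∀ a → + 0 ℤ.≤ a * a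
square-nonneg (+ n)    = subst (+ 0 ℤ.≤_) (sym (ℤP.+◃n≡+n (n ℕ.* n))) (+≤+ z≤n)
square-nonneg -[1+ n ] = +≤+ z≤n

sumSquares-nonneg : ∀ k (a : Fin k → ℤ) → + 0 ℤ.≤ sumℤ k (λ i → a i * a i)
sumSquares-nonneg zero    a = ℤP.≤-refl
sumSquares-nonneg (suc k) a =
  ℤP.+-mono-≤ (square-nonneg (a fzero)) (sumSquares-nonneg k (λ i → a (fsuc i)))

summands-bounded : ∀ {x y c} → + 0 ℤ.≤ x → + 0 ℤ.≤ y → x + y ℤ.≤ c → x ℤ.≤ c × y ℤ.≤ c
summands-bounded {x} {y} 0≤x 0≤y x+y≤c =
  ℤP.≤-trans (ℤP.≤-trans (ℤP.≤-reflexive (sym (ℤP.+-identityʳ x))) (ℤP.+-monoʳ-≤ x 0≤y)) x+y≤c ,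
  ℤP.≤-trans (ℤP.≤-trans (ℤP.≤-reflexive (sym (ℤP.+-identityˡ y))) (ℤP.+-monoˡ-≤ y 0≤x)) x+y≤c

large-square : ∀ k → suc (suc (suc k)) ℕ.* suc (suc (suc k)) ℕ.≤ 8 → ⊥
large-square k h = ℕP.<-irrefl refl (ℕP.≤-trans (ℕP.*-mono-≤ (ℕP.m≤m+n 3 k) (ℕP.m≤m+n 3 k)) h)

data Shape : ℤ → Set where
  null   : Shape (+ 0)
  unit   : ∀ ε → ε * ε ≡ + 1 → Shape ε
  double : ∀ ε → ε * ε ≡ + 1 → Shape (+ 2 * ε)

shape : ∀ a → a * a ℤ.≤ + 8 → Shape a
shape (+ 0)                   _          = null
shape (+ 1)                   _          = unit (+ 1) refl
shape (+ 2)                   _          = double (+ 1) refl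
shape (+ suc (suc (suc k)))   (+≤+ a²≤8) = ⊥-elim (large-square k a²≤8)
shape -[1+ 0 ]                _          = unit -[1+ 0 ] refl
shape -[1+ 1 ]                _          = double -[1+ 0 ] refl
shape -[1+ suc (suc k) ]      (+≤+ a²≤8) = ⊥-elim (large-square k a²≤8)

-- The entries (a_i, b_i) of a Gram datum (m, A, D, B) with all a_i ∈ {0, ±1, ±2},
-- sorted by a_i: `units` holds ε b_i for a_i = ε = ±1, `zeros` holds b_i for
-- a_i = 0, and `doubles` holds ε b_i for a_i = 2ε.
record Split (m : ℕ) (A D B : ℤ) : Set where
  field
    units zeros doubles : List ℤ
    count : m ≡ length units ℕ.+ length zeros ℕ.+ length doubles
    norm  : A ≡ + (length units ℕ.+ 4 ℕ.* length doubles)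
    dot   : D ≡ sumList units + + 2 * sumList doubles
    sqs   : B ≡ squareSum units + squareSum zeros + squareSum doubles

sign-square : ∀ ε β → ε * ε ≡ + 1 → (ε * β) * (ε * β) ≡ β * β
sign-square ε β ε²≡1 = begin
  (ε * β) * (ε * β) ≡⟨ regroup ε β ⟩
  (ε * ε) * (β * β) ≡⟨ cong (_* (β * β)) ε²≡1 ⟩
  + 1 * (β * β)     ≡⟨ ℤP.*-identityˡ (β * β) ⟩
  β * β             ∎
  where
    open ≡-Reasoning
    regroup : ∀ ε β → (ε * β) * (ε * β) ≡ (ε * ε) * (β * β)
    regroup = solve-∀

extend : ∀ {m A D B α} → Shape α → (β : ℤ) → Split m A D B →
  Split (suc m) (α * α + A) (α * β + D) (β * β + B)
extend {A = A} {D = D} null β sp = record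
  { units = units ; zeros = β ∷ zeros ; doubles = doubles
  ; count = trans (cong suc count)
                  (cong (ℕ._+ length doubles) (sym (ℕP.+-suc (length units) (length zeros))))
  ; norm  = trans (ℤP.+-identityˡ A) norm
  ; dot   = trans (ℤP.+-identityˡ D) dot
  ; sqs   = trans (cong (_+_ (β * β)) sqs) 
                  (regroup (β * β) (squareSum units) (squareSum zeros) (squareSum doubles))
  }
  where
    open Split sp
    regroup : ∀ y U Z W → y + (U + Z + W) ≡ U + (y + Z) + W
    regroup = solve-∀
extend (unit ε ε²≡1) β sp = record
  { units = ε * β ∷ units ; zeros = zeros ; doubles = doubles
  ; count = cong suc count
  ; norm  = cong₂ _+_ ε²≡1 norm
  ; dot   = trans (cong (_+_ (ε * β)) dot)
                  (sym (ℤP.+-assoc (ε * β) (sumList units) (+ 2 * sumList doubles)))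
  ; sqs   = trans (cong₂ _+_ (sym (sign-square ε β ε²≡1)) sqs) 
                  (regroup ((ε * β) * (ε * β)) (squareSum units) (squareSum zeros) (squareSum doubles))
  }
  where
    open Split sp
    regroup : ∀ y U Z W → y + (U + Z + W) ≡ (y + U) + Z + W
    regroup = solve-∀
extend (double ε ε²≡1) β sp = record
  { units = units ; zeros = zeros ; doubles = ε * β ∷ doubles
  ; count = trans (cong suc count) (sym (ℕP.+-suc (length units ℕ.+ length zeros) (length doubles)))
  ; norm  = trans (cong₂ _+_ (double-square ε ε²≡1) norm)
                  (cong +_ (four-more (length units) (length doubles)))
  ; dot   = trans (cong (_+_ ((+ 2 * ε) * β)) dot)
                  (regroupDot ε β (sumList units) (sumList doubles))
  ; sqs   = trans (cong₂ _+_ (sym (sign-square ε β ε²≡1)) sqs) 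
                  (regroup ((ε * β) * (ε * β)) (squareSum units) (squareSum zeros) (squareSum doubles))
  }
  where
    open Split sp
    double-square : ∀ ε → ε * ε ≡ + 1 → (+ 2 * ε) * (+ 2 * ε) ≡ + 4
    double-square ε ε²≡1 = trans (quadruple ε) (cong (+ 4 *_) ε²≡1)
      where
        quadruple : ∀ ε → (+ 2 * ε) * (+ 2 * ε) ≡ + 4 * (ε * ε)
        quadruple = solve-∀
    four-more : ∀ u d → 4 ℕ.+ (u ℕ.+ 4 ℕ.* d) ≡ u ℕ.+ 4 ℕ.* suc d
    four-more = ℕSolver.solve-∀
    regroupDot : ∀ ε β U W → (+ 2 * ε) * β + (U + + 2 * W) ≡ U + + 2 * (ε * β + W)
    regroupDot = solve-∀
    regroup : ∀ y U Z W → y + (U + Z + W) ≡ U + Z + (y + W)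
    regroup = solve-∀

split : ∀ {m A D B} → A ℤ.≤ + 8 → Gram m A D B → Split m A D B
split {zero}  _      (a , b , refl , refl , refl) = record
  { units = [] ; zeros = [] ; doubles = [] ; count = refl ; norm = refl ; dot = refl ; sqs = refl }
split {suc m} |a|²≤8 (a , b , refl , refl , refl) =
  extend (shape (a fzero) (proj₁ bounds)) (b fzero)
         (split (proj₂ bounds) ((λ i → a (fsuc i)) , (λ i → b (fsuc i)) , refl , refl , refl))
  where
    bounds : (a fzero * a fzero ℤ.≤ + 8) × (sumℤ m (λ i → a (fsuc i) * a (fsuc i)) ℤ.≤ + 8)
    bounds = summands-bounded (square-nonneg (a fzero))
                              (sumSquares-nonneg m (λ i → a (fsuc i))) |a|²≤8

zeros-balance : ∀ u z d → u ℕ.+ z ℕ.+ d ≡ u ℕ.+ 4 ℕ.* d → z ≡ 3 ℕ.* d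
zeros-balance u z d h = ℕP.+-cancelʳ-≡ d z (3 ℕ.* d)
  (trans (ℕP.+-cancelˡ-≡ u (z ℕ.+ d) (4 ℕ.* d) (trans (sym (ℕP.+-assoc u z d)) h))
         (ℕP.+-comm d (3 ℕ.* d)))

at-most-one-double : ∀ u d → u ℕ.+ 4 ℕ.* d ℕ.≤ 7 → d ℕ.≤ 1
at-most-one-double u 0             _ = z≤n
at-most-one-double u 1             _ = s≤s z≤n
at-most-one-double u (suc (suc k)) h = ⊥-elim (ℕP.<-irrefl refl
  (ℕP.≤-trans (ℕP.≤-trans (ℕP.*-monoʳ-≤ 4 (ℕP.m≤m+n 2 k)) (ℕP.m≤n+m _ u)) h))

Realizable-cast : ∀ {k k′ T T′ N N′} → k ≡ k′ → T ≡ T′ → N ≡ N′ →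
  Realizable k T N → Realizable k′ T′ N′
Realizable-cast refl refl refl r = r

-- In the case of one double s and zeros u, v, w, the parity of T - n is the
-- parity of s + u + v + w, because x ≡ x² (mod 2) for the other entries.
double-parity : ∀ U s u v w →
  Even ((sumList U + + 2 * s) - (squareSum U + (s * s + u * u + v * v + w * w))) →
  Even (s + u + v + w)
double-parity U s u v w T-n-even = subst Even (sym (regroup (sumList U) (squareSum U) s u v w))
  (Signed.∣m∣n⇒∣m+n
    (Signed.∣m∣n⇒∣m-n (Signed.∣m∣n⇒∣m+n (sum-parity (s ∷ u ∷ v ∷ w ∷ [])) (sum-parity U)) T-n-even)
    (Signed.divides s (ℤP.*-comm (+ 2) s)))
  where
    regroup : ∀ Σ Σ² s u v w → s + u + v + w ≡
      ((((s + (u + (v + (w + + 0)))) - (s * s + (u * u + (v * v + (w * w + + 0))))) + (Σ - Σ²))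
        - ((Σ + + 2 * s) - (Σ² + (s * s + u * u + v * v + w * w))))
      + + 2 * s
    regroup = solve-∀

realize : ∀ {m T n} → m ℕ.≤ 7 → (4 ℕ.≤ m → Even (T - + n)) → Split m (+ m) T (+ n) →
  Realizable m T (+ n)
realize {m} {T} {n} m≤7 parity sp =
  byShape units zeros doubles m≡
    (zeros-balance (length units) (length zeros) (length doubles) (trans (sym count) m≡))
    (at-most-one-double (length units) (length doubles) (subst (ℕ._≤ 7) m≡ m≤7)) dot sqs
  where
    open Split sp
    m≡ : m ≡ length units ℕ.+ 4 ℕ.* length doubles
    m≡ = ℤP.+-injective norm
    byShape : ∀ U Z W → m ≡ length U ℕ.+ 4 ℕ.* length W →
      length Z ≡ 3 ℕ.* length W → length W ℕ.≤ 1 →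
      T ≡ sumList U + + 2 * sumList W →
      + n ≡ squareSum U + squareSum Z + squareSum W → Realizable m T (+ n)
    byShape U [] [] m≡ _ _ T≡ n≡ =
      Realizable-cast (sym (trans m≡ (ℕP.+-identityʳ _))) (sym (trans T≡ (ℤP.+-identityʳ _)))
        (sym (trans n≡ (trans (ℤP.+-identityʳ _) (ℤP.+-identityʳ _))))
        (U , refl , refl , refl)
    byShape U (u ∷ v ∷ w ∷ []) (s ∷ []) m≡ _ _ T≡ n≡ =
      Realizable-cast (sym m≡) (sym T≡′) (sym n≡′)
        (Realizable-++ (U , refl , refl , refl)
          (replace-double s u v w (double-parity U s u v w
            (subst Even (cong₂ _-_ T≡′ n≡′) (parity 4≤m)))))
      where
        4≤m : 4 ℕ.≤ m
        4≤m = subst (4 ℕ.≤_) (sym m≡) (ℕP.m≤n+m 4 (length U))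
        T≡′ : T ≡ sumList U + + 2 * s
        T≡′ = trans T≡ (cong (λ x → sumList U + + 2 * x) (ℤP.+-identityʳ s))
        n≡′ : + n ≡ squareSum U + (s * s + u * u + v * v + w * w)
        n≡′ = trans n≡ (regroup (squareSum U) s u v w)
          where
            regroup : ∀ U² s u v w → U² + (u * u + (v * v + (w * w + + 0))) + (s * s + + 0)
                                     ≡ U² + (s * s + u * u + v * v + w * w)
            regroup = solve-∀
    byShape U (_ ∷ _) []                   _ ()
    byShape U []                  (_ ∷ []) _ ()
    byShape U (_ ∷ [])            (_ ∷ []) _ ()
    byShape U (_ ∷ _ ∷ [])        (_ ∷ []) _ ()
    byShape U (_ ∷ _ ∷ _ ∷ _ ∷ _) (_ ∷ []) _ ()
    byShape U Z (_ ∷ _ ∷ _) _ _ (s≤s ())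

Realizable-parity : ∀ {k T N} → Realizable k T N → Even (T - N)
Realizable-parity (xs , _ , refl , refl) = sum-parity xs

realisation⇒forms : ∀ m n T → S m n T → SumOfSquaresOfLinearForms m (+ m) T (+ n)
realisation⇒forms m n T (x , Σx≡T , Σx²≡n) = Equivalence.from (SumOfSquares⇔Gram m (+ m) T (+ n))
  ((λ _ → + 1) , x , sumℤ-one m , trans (sumℤ-cong m (λ i → ℤP.*-identityˡ (x i))) Σx≡T , Σx²≡n)

forms⇒realisation : ∀ m n T → m ℕ.≤ 7 → (4 ℕ.≤ m → Even (T - + n)) →
  SumOfSquaresOfLinearForms m (+ m) T (+ n) → S m n T
forms⇒realisation m n T m≤7 parity forms = Equivalence.from (S⇔Realizable m n T)
  (realize m≤7 parity (split (+≤+ (ℕP.m≤n⇒m≤1+n m≤7))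
    (Equivalence.to (SumOfSquares⇔Gram m (+ m) T (+ n)) forms)))

two-or-three≤3 : ∀ {m} → m ≡ 2 ⊎ m ≡ 3 → m ℕ.≤ 3
two-or-three≤3 (inj₁ refl) = ℕP.m≤m+n 2 1
two-or-three≤3 (inj₂ refl) = ℕP.≤-refl

proposition3p1 : (m n : ℕ) → .{{NonZero n}} → (T : ℤ) →
    ((m ≡ 2 ⊎ m ≡ 3) →
      (S m n T ⇔ SumOfSquaresOfLinearForms m (+ m) T (+ n)))
    × ((4 ≤ m × m ≤ 7) →
      (S m n T ⇔ ((+ 2 ∣ T - + n) × SumOfSquaresOfLinearForms m (+ m) T (+ n))))
proposition3p1 m n T = small , large
  where
    small : (m ≡ 2 ⊎ m ≡ 3) → (S m n T ⇔ SumOfSquaresOfLinearForms m (+ m) T (+ n))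
    small m≡2or3 = mk⇔ (realisation⇒forms m n T)
      (forms⇒realisation m n T (ℕP.≤-trans m≤3 (ℕP.m≤m+n 3 4))
                               (λ 4≤m → ⊥-elim (ℕP.<⇒≱ (s≤s m≤3) 4≤m)))
      where
        m≤3 : m ℕ.≤ 3
        m≤3 = two-or-three≤3 m≡2or3
    large : (4 ≤ m × m ≤ 7) →
      (S m n T ⇔ ((+ 2 ∣ T - + n) × SumOfSquaresOfLinearForms m (+ m) T (+ n)))
    large (_ , m≤7) = mk⇔
      (λ x → Signed.∣⇒∣ᵤ (Realizable-parity (Equivalence.to (S⇔Realizable m n T) x)) ,
             realisation⇒forms m n T x)
      (λ (T≡n , forms) → forms⇒realisation m n T m≤7 (λ _ → Signed.∣ᵤ⇒∣ T≡n) forms)
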